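{- Let $\mathcal M=\mathrm{CM}(G,X,p)$ be a regular Cayley map with associated skew-morphism $\psi$ and power function $\pi$. Then $\mathrm{Ker}(\pi)\cong L(G)\cap \psi^{ -1}L(G)\psi$.
   Context: For a finite group $G$, a generating subset $X\subseteq G$ with $X=X^{ -1}$, $1_G\notin X$, and a cyclic permutation $p$ of $X$, the Cayley map $\mathrm{CM}(G,X,p)$ is the map with underlying Cayley graph $\mathrm{Cay}(G,X)$ and rotation $(g,gx)\mapsto(g,g\,p(x))$; it is regular if its map automorphism group (permutations of darts commuting with rotation and dart-reversal) is transitive on darts. A skew-morphism of $G$ is a permutation $\psi$ of $G$ fixing $1_G$ with a function $\pi:G\to\{1,\dots,r\}$ ($r$ the order of $\psi$) such that $\psi(gh)=\psi(g)\psi^{\pi(g)}(h)$ for all $g,h$; $\pi$ is its power function. $\mathrm{CM}(G,X,p)$ is regular iff some skew-morphism $\psi$ of $G$ agrees with $p$ on $X$; this $\psi$ and its $\pi$ are unique (the associated skew-morphism and power function). $\mathrm{Ker}(\pi)=\{g\in G:\pi(g)=1\}$. $L(G)=\{L_g:g\in G\}$ with $L_g(h)=gh$; both $L(G)$ and $\psi$ are viewed as permutations of $G$ (the automorphism group of the map, acting on vertices, equals $L(G)\langle\psi\rangle$). -}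

module Defs where

open import Data.Nat using (ℕ; zero; suc; _≤_; _<_)
open import Data.Fin using (Fin)
open import Data.Fin.Subset using (Subset; _∈_; _∉_)
open import Data.Fin.Permutation using (Permutation′; _⟨$⟩ʳ_; _⟨$⟩ˡ_)
open import Data.List using (List; foldr)
open import Data.List.Relation.Unary.All using (All)
open import Data.Product using (Σ; ∃; _×_; _,_; proj₁)
open import Data.Sum using (_⊎_)
open import Relation.Nullary using (¬_)
open import Relation.Binary.PropositionalEquality using (_≡_)
open import Algebra.Structures using (IsGroup)

record FinGroup (n : ℕ) : Set where
  field
    _∙_     : Fin n → Fin n → Fin n
    ε       : Fin n
    _⁻¹     : Fin n → Fin n
    isGroup : IsGroup _≡_ _∙_ ε _⁻¹
  infixl 7 _∙_
  infix 8 _⁻¹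

iter : ∀ {A : Set} → (A → A) → ℕ → A → A
iter f zero    x = x
iter f (suc k) x = f (iter f k x)

module _ {n : ℕ} (G : FinGroup n) where
  open FinGroup G

  Generates : Subset n → Set
  Generates X = ∀ g → Σ (List (Fin n)) λ ws →
    All (λ w → w ∈ X ⊎ (w ⁻¹) ∈ X) ws × foldr _∙_ ε ws ≡ g

  IsCayleySet : Subset n → Set
  IsCayleySet X = Generates X × (∀ x → x ∈ X → (x ⁻¹) ∈ X) × ε ∉ X

  -- p (a function on G, only its restriction to X matters) restricts to a
  -- cyclic permutation of X: it maps X into X and acts transitively on X
  -- (for a finite set this is exactly a single cycle through all of X).
  IsCyclicPermOn : Subset n → (Fin n → Fin n) → Set
  IsCyclicPermOn X p = (∀ x → x ∈ X → p x ∈ X)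
    × (∀ x y → x ∈ X → y ∈ X → ∃ λ k → iter p k x ≡ y)

  IsOrder : Permutation′ n → ℕ → Set
  IsOrder ψ r = 1 ≤ r × (∀ g → iter (ψ ⟨$⟩ʳ_) r g ≡ g)
    × (∀ k → 1 ≤ k → k < r → ¬ (∀ g → iter (ψ ⟨$⟩ʳ_) k g ≡ g))

  IsSkewMorphism : Permutation′ n → (Fin n → ℕ) → Set
  IsSkewMorphism ψ π = (ψ ⟨$⟩ʳ ε) ≡ ε × Σ ℕ λ r → IsOrder ψ r
    × (∀ g → 1 ≤ π g × π g ≤ r)
    × (∀ g h → ψ ⟨$⟩ʳ (g ∙ h) ≡ (ψ ⟨$⟩ʳ g) ∙ iter (ψ ⟨$⟩ʳ_) (π g) h)

  IsRegularCayleyMapWith : Subset n → (Fin n → Fin n) → Permutation′ n → (Fin n → ℕ) → Set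
  IsRegularCayleyMapWith X p ψ π = IsCayleySet X × IsCyclicPermOn X p
    × IsSkewMorphism ψ π × (∀ x → x ∈ X → ψ ⟨$⟩ʳ x ≡ p x)

  Ker : (Fin n → ℕ) → Set
  Ker π = Σ (Fin n) λ g → π g ≡ 1

  L : Fin n → Fin n → Fin n
  L g h = g ∙ h

  -- σ ∈ L(G) ∩ ψ⁻¹ L(G) ψ   (permutations of G as functions, compared pointwise)
  InLcapConj : Permutation′ n → (Fin n → Fin n) → Set
  InLcapConj ψ σ = (∃ λ g → ∀ x → σ x ≡ L g x)
    × (∃ λ h → ∀ x → σ x ≡ ψ ⟨$⟩ˡ (L h (ψ ⟨$⟩ʳ x)))

  LcapConj : Permutation′ n → Set
  LcapConj ψ = Σ (Fin n → Fin n) (InLcapConj ψ)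

  _≗P_ : (Fin n → Fin n) → (Fin n → Fin n) → Set
  σ ≗P τ = ∀ x → σ x ≡ τ x

  -- group isomorphism Ker(π) ≅ L(G) ∩ ψ⁻¹L(G)ψ (operations: ∙ on Ker(π),
  -- composition on permutations): a bijective homomorphism.
  KerIso : (Fin n → ℕ) → Permutation′ n → Set
  KerIso π ψ = Σ (Ker π → LcapConj ψ) λ Φ →
      (∀ (a b c : Ker π) → proj₁ c ≡ proj₁ a ∙ proj₁ b →
          proj₁ (Φ c) ≗P (λ x → proj₁ (Φ a) (proj₁ (Φ b) x)))
    × (∀ (a b : Ker π) → proj₁ (Φ a) ≗P proj₁ (Φ b) → proj₁ a ≡ proj₁ b)
    × (∀ (s : LcapConj ψ) → ∃ λ (a : Ker π) → proj₁ (Φ a) ≗P proj₁ s)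

{-# OPTIONS --safe #-}

-- For g ∈ Ker π the skew-morphism law reads ψ(g x) = ψ(g) ψ(x), i.e.
-- L_g = ψ⁻¹ L_{ψ(g)} ψ, so g ↦ L_g embeds Ker π into L(G) ∩ ψ⁻¹ L(G) ψ.
-- Conversely, if L_g = ψ⁻¹ L_h ψ then evaluating at 1 gives h = ψ(g), and
-- cancelling ψ(g) against the skew-morphism law leaves ψ^{π(g)} = ψ; as
-- 1 ≤ π(g) ≤ r and ψ has order r, this forces π(g) = 1.
module Submission where

open import Defs
open import Level using (0ℓ)
open import Algebra.Bundles using (Group)
import Algebra.Properties.Group as GroupProperties
open import Data.Nat using (ℕ; zero; suc; _≤_; _<_; s≤s; z≤n)
open import Data.Fin using (Fin)
open import Data.Fin.Subset using (Subset)
open import Data.Fin.Permutation as Permutation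
  using (Permutation′; _⟨$⟩ʳ_; _⟨$⟩ˡ_)
open import Data.Product using (∃; _×_; _,_; proj₁; proj₂)
open import Data.Empty using (⊥-elim)
open import Function using (id)
open import Function.Bundles using (Injection)
open import Function.Properties.Inverse using (Inverse⇒Injection)
open import Relation.Binary.PropositionalEquality
open import Algebra.Structures using (IsGroup)

module _ {n : ℕ} (G : FinGroup n) where
  open FinGroup G
  open IsGroup isGroup using (assoc; identityʳ)

  group : Group 0ℓ 0ℓ
  group = record { isGroup = isGroup }

  open GroupProperties group using (∙-cancelˡ)

  order-minimal : ∀ ψ {r} m → IsOrder G ψ r → m < r →
                  iter (ψ ⟨$⟩ʳ_) m ≗ id → m ≡ 0
  order-minimal _ zero    _                  _   _     = refl
  order-minimal _ (suc m) (_ , _ , minimal) m<r ψᵐ≗id =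
    ⊥-elim (minimal (suc m) (s≤s z≤n) m<r ψᵐ≗id)

  power≗self⇒≡1 : ∀ ψ {r} k → IsOrder G ψ r → 1 ≤ k → k ≤ r →
                  iter (ψ ⟨$⟩ʳ_) k ≗ ψ ⟨$⟩ʳ_ → k ≡ 1
  power≗self⇒≡1 ψ (suc m) order _ m<r ψ¹⁺ᵐ≗ψ =
    cong suc (order-minimal ψ m order m<r (λ x → ψ-injective (ψ¹⁺ᵐ≗ψ x)))
    where
    ψ-injective : ∀ {x y} → ψ ⟨$⟩ʳ x ≡ ψ ⟨$⟩ʳ y → x ≡ y
    ψ-injective = Injection.injective (Inverse⇒Injection ψ)

  module SkewMorphism (ψ : Permutation′ n) {π : Fin n → ℕ}
                      (skew : IsSkewMorphism G ψ π) where

    ψ^_ : ℕ → Fin n → Fin n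
    ψ^_ = iter (ψ ⟨$⟩ʳ_)

    ψ-ε : ψ ⟨$⟩ʳ ε ≡ ε
    ψ-ε = proj₁ skew

    r : ℕ
    r = proj₁ (proj₂ skew)

    ψ-order : IsOrder G ψ r
    ψ-order = proj₁ (proj₂ (proj₂ skew))

    π-bounds : ∀ g → 1 ≤ π g × π g ≤ r
    π-bounds = proj₁ (proj₂ (proj₂ (proj₂ skew)))

    ψ-∙ : ∀ g h → ψ ⟨$⟩ʳ (g ∙ h) ≡ (ψ ⟨$⟩ʳ g) ∙ (ψ^ π g) h
    ψ-∙ = proj₂ (proj₂ (proj₂ (proj₂ skew)))

    kernel⇒ψ-∙ : ∀ {g} → π g ≡ 1 →
                 ∀ x → ψ ⟨$⟩ʳ (g ∙ x) ≡ (ψ ⟨$⟩ʳ g) ∙ (ψ ⟨$⟩ʳ x)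
    kernel⇒ψ-∙ {g} πg≡1 x = begin
      ψ ⟨$⟩ʳ (g ∙ x)             ≡⟨ ψ-∙ g x ⟩
      (ψ ⟨$⟩ʳ g) ∙ (ψ^ π g) x    ≡⟨ cong (λ k → (ψ ⟨$⟩ʳ g) ∙ (ψ^ k) x) πg≡1 ⟩
      (ψ ⟨$⟩ʳ g) ∙ (ψ ⟨$⟩ʳ x)    ∎
      where open ≡-Reasoning

    kernel⇒conjugate-translation : ∀ {g} → π g ≡ 1 →
      ∀ x → g ∙ x ≡ ψ ⟨$⟩ˡ ((ψ ⟨$⟩ʳ g) ∙ (ψ ⟨$⟩ʳ x))
    kernel⇒conjugate-translation {g} πg≡1 x = begin
      g ∙ x                                  ≡⟨ Permutation.inverseˡ ψ ⟨
      ψ ⟨$⟩ˡ (ψ ⟨$⟩ʳ (g ∙ x))                ≡⟨ cong (ψ ⟨$⟩ˡ_) (kernel⇒ψ-∙ πg≡1 x) ⟩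
      ψ ⟨$⟩ˡ ((ψ ⟨$⟩ʳ g) ∙ (ψ ⟨$⟩ʳ x))       ∎
      where open ≡-Reasoning

    conjugate-translation⇒intertwining : ∀ {g h} →
      (∀ x → g ∙ x ≡ ψ ⟨$⟩ˡ (h ∙ (ψ ⟨$⟩ʳ x))) →
      ∀ x → ψ ⟨$⟩ʳ (g ∙ x) ≡ h ∙ (ψ ⟨$⟩ʳ x)
    conjugate-translation⇒intertwining {g} {h} E x = begin
      ψ ⟨$⟩ʳ (g ∙ x)                   ≡⟨ cong (ψ ⟨$⟩ʳ_) (E x) ⟩
      ψ ⟨$⟩ʳ (ψ ⟨$⟩ˡ (h ∙ (ψ ⟨$⟩ʳ x)))  ≡⟨ Permutation.inverseʳ ψ ⟩
      h ∙ (ψ ⟨$⟩ʳ x)                   ∎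
      where open ≡-Reasoning

    intertwining⇒≡ψ : ∀ {g h} → (∀ x → ψ ⟨$⟩ʳ (g ∙ x) ≡ h ∙ (ψ ⟨$⟩ʳ x)) →
                      h ≡ ψ ⟨$⟩ʳ g
    intertwining⇒≡ψ {g} {h} E = begin
      h                  ≡⟨ identityʳ h ⟨
      h ∙ ε              ≡⟨ cong (h ∙_) ψ-ε ⟨
      h ∙ (ψ ⟨$⟩ʳ ε)     ≡⟨ E ε ⟨
      ψ ⟨$⟩ʳ (g ∙ ε)     ≡⟨ cong (ψ ⟨$⟩ʳ_) (identityʳ g) ⟩
      ψ ⟨$⟩ʳ g           ∎
      where open ≡-Reasoning

    intertwining⇒power≗ψ : ∀ {g h} → (∀ x → ψ ⟨$⟩ʳ (g ∙ x) ≡ h ∙ (ψ ⟨$⟩ʳ x)) →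
                           ψ^ π g ≗ ψ ⟨$⟩ʳ_
    intertwining⇒power≗ψ {g} {h} E x = ∙-cancelˡ (ψ ⟨$⟩ʳ g) _ _ (begin
      (ψ ⟨$⟩ʳ g) ∙ (ψ^ π g) x   ≡⟨ ψ-∙ g x ⟨
      ψ ⟨$⟩ʳ (g ∙ x)            ≡⟨ E x ⟩
      h ∙ (ψ ⟨$⟩ʳ x)            ≡⟨ cong (_∙ (ψ ⟨$⟩ʳ x)) (intertwining⇒≡ψ E) ⟩
      (ψ ⟨$⟩ʳ g) ∙ (ψ ⟨$⟩ʳ x)   ∎)
      where open ≡-Reasoning

    intertwining⇒kernel : ∀ {g h} → (∀ x → ψ ⟨$⟩ʳ (g ∙ x) ≡ h ∙ (ψ ⟨$⟩ʳ x)) →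
                          π g ≡ 1
    intertwining⇒kernel {g} E =
      power≗self⇒≡1 ψ (π g) ψ-order (proj₁ (π-bounds g)) (proj₂ (π-bounds g))
                    (intertwining⇒power≗ψ E)

    translation : Ker G π → LcapConj G ψ
    translation (g , πg≡1) =
      L G g , (g , λ _ → refl) , (ψ ⟨$⟩ʳ g , kernel⇒conjugate-translation πg≡1)

    translation-∙ : ∀ (a b c : Ker G π) → proj₁ c ≡ proj₁ a ∙ proj₁ b →
                    _≗P_ G (proj₁ (translation c))
                           (λ x → proj₁ (translation a) (proj₁ (translation b) x))
    translation-∙ (a , _) (b , _) (c , _) c≡ab x = begin
      c ∙ x          ≡⟨ cong (_∙ x) c≡ab ⟩
      (a ∙ b) ∙ x    ≡⟨ assoc a b x ⟩
      a ∙ (b ∙ x)    ∎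
      where open ≡-Reasoning

    translation-injective : ∀ (a b : Ker G π) →
      _≗P_ G (proj₁ (translation a)) (proj₁ (translation b)) → proj₁ a ≡ proj₁ b
    translation-injective (a , _) (b , _) La≗Lb = begin
      a        ≡⟨ identityʳ a ⟨
      a ∙ ε    ≡⟨ La≗Lb ε ⟩
      b ∙ ε    ≡⟨ identityʳ b ⟩
      b        ∎
      where open ≡-Reasoning

    translation-surjective : ∀ (s : LcapConj G ψ) →
      ∃ λ (a : Ker G π) → _≗P_ G (proj₁ (translation a)) (proj₁ s)
    translation-surjective (σ , (g , σ≗Lg) , (h , σ≗ψ⁻¹Lhψ)) =
      (g , intertwining⇒kernel (conjugate-translation⇒intertwining Lg≗ψ⁻¹Lhψ)) ,
      λ x → sym (σ≗Lg x)
      where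
      Lg≗ψ⁻¹Lhψ : ∀ x → g ∙ x ≡ ψ ⟨$⟩ˡ (h ∙ (ψ ⟨$⟩ʳ x))
      Lg≗ψ⁻¹Lhψ x = trans (sym (σ≗Lg x)) (σ≗ψ⁻¹Lhψ x)

lemma4p1 : ∀ {n} (G : FinGroup n) (X : Subset n) (p : Fin n → Fin n)
    (ψ : Permutation′ n) (π : Fin n → ℕ) →
    IsRegularCayleyMapWith G X p ψ π → KerIso G π ψ
lemma4p1 G X p ψ π (_ , _ , skew , _) =
  translation , translation-∙ , translation-injective , translation-surjective
  where open SkewMorphism G ψ skew
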